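{- Let $\mathcal{C}$ be a cartesian bicategory. For all coreflexives $f,g\colon X\to X$: (1) $f;\mathrm{copy}_X=\mathrm{copy}_X;(f\otimes\mathrm{id}_X)$; (2) $f;g=f\sqcap g$; (3) $f;f=f$; (4) $f=f^{\dagger}$; (5) $f$ is single valued; (6) $f$ is injective. Moreover: (7) the maps $i(h):=\mathrm{codisc}_X;h$ (for coreflexive $h\colon X\to X$) and $c(k):=(k\otimes\mathrm{id}_X);\mathrm{cocopy}_X$ (for $k\colon I\to X$) are mutually inverse bijections between the set of coreflexives $X\to X$ and $\mathcal{C}(I,X)$; (8) for every $h\colon I\to X$ and every coreflexive $g\colon X\to X$, $h;g=h\sqcap i(g)$; (9) every $f\colon X\to X$ that satisfies $f;f=f$, $f=f^{\dagger}$ and is single valued is a coreflexive.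
   Context: Composition is diagrammatic; unitors $I\otimes X\cong X$ are left implicit. A cartesian bicategory is a poset-enriched symmetric monoidal category $(\mathcal{C},\otimes,I)$ in which every object $X$ has a commutative monoid $(\mathrm{cocopy}_X\colon X\otimes X\to X,\ \mathrm{codisc}_X\colon I\to X)$ and a cocommutative comonoid $(\mathrm{copy}_X\colon X\to X\otimes X,\ \mathrm{disc}_X\colon X\to I)$, coherent with $\otimes$, such that: every $f\colon X\to Y$ is a lax comonoid homomorphism ($f;\mathrm{copy}_Y\le\mathrm{copy}_X;(f\otimes f)$ and $f;\mathrm{disc}_Y\le\mathrm{disc}_X$); the monoid and comonoid on $X$ form a special Frobenius bimonoid; and $\mathrm{codisc}_X;\mathrm{disc}_X\le\mathrm{id}_I$, $\mathrm{cocopy}_X;\mathrm{copy}_X\le\mathrm{id}_{X\otimes X}$, $\mathrm{id}_X\le\mathrm{disc}_X;\mathrm{codisc}_X$, $\mathrm{id}_X\le\mathrm{copy}_X;\mathrm{cocopy}_X$. For $f,g\colon X\to Y$, $f\sqcap g:=\mathrm{copy}_X;(f\otimes g);\mathrm{cocopy}_Y$. The converse of $f\colon X\to Y$ is $f^\dagger:=(\mathrm{id}_Y\otimes(\mathrm{codisc}_X;\mathrm{copy}_X));(\mathrm{id}_Y\otimes f\otimes\mathrm{id}_X);((\mathrm{cocopy}_Y;\mathrm{disc}_Y)\otimes\mathrm{id}_X)\colon Y\to X$. A morphism $f\colon X\to X$ is a coreflexive if $f\le\mathrm{id}_X$. A morphism $f\colon X\to Y$ is single valued if $\mathrm{copy}_X;(f\otimes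 f)\le f;\mathrm{copy}_Y$ (equivalently $f^\dagger;f\le\mathrm{id}_Y$), and injective if $(f\otimes f);\mathrm{cocopy}_Y\le\mathrm{cocopy}_X;f$ (equivalently $f;f^\dagger\le\mathrm{id}_X$). -}

module Defs where

open import Level using (Level; _⊔_; suc)
open import Relation.Binary.PropositionalEquality using (_≡_)
open import Data.Product using (_×_)

-- Composition _⨾_ is diagrammatic: f ⨾ g means "first f, then g".
record CartesianBicategory (o ℓ e : Level) : Set (suc (o ⊔ ℓ ⊔ e)) where
  infixr 9 _⨾_
  infixr 10 _⊗₁_
  infixr 10 _⊗₀_
  infix 4 _≤_
  field
    Obj  : Set o
    Hom  : Obj → Obj → Set ℓ
    _≤_  : ∀ {X Y} → Hom X Y → Hom X Y → Set e
    id   : ∀ {X} → Hom X X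
    _⨾_  : ∀ {X Y Z} → Hom X Y → Hom Y Z → Hom X Z
    _⊗₀_ : Obj → Obj → Obj
    I    : Obj
    _⊗₁_ : ∀ {X Y X' Y'} → Hom X Y → Hom X' Y' → Hom (X ⊗₀ X') (Y ⊗₀ Y')

    identityˡ : ∀ {X Y} {f : Hom X Y} → id ⨾ f ≡ f
    identityʳ : ∀ {X Y} {f : Hom X Y} → f ⨾ id ≡ f
    assoc     : ∀ {W X Y Z} {f : Hom W X} {g : Hom X Y} {h : Hom Y Z} →
                (f ⨾ g) ⨾ h ≡ f ⨾ (g ⨾ h)
    ⊗-id      : ∀ {X Y} → id {X} ⊗₁ id {Y} ≡ id
    ⊗-⨾       : ∀ {X Y Z X' Y' Z'} {f : Hom X Y} {g : Hom Y Z}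
                  {f' : Hom X' Y'} {g' : Hom Y' Z'} →
                (f ⨾ g) ⊗₁ (f' ⨾ g') ≡ (f ⊗₁ f') ⨾ (g ⊗₁ g')

    ≤-refl    : ∀ {X Y} {f : Hom X Y} → f ≤ f
    ≤-trans   : ∀ {X Y} {f g h : Hom X Y} → f ≤ g → g ≤ h → f ≤ h
    ≤-antisym : ∀ {X Y} {f g : Hom X Y} → f ≤ g → g ≤ f → f ≡ g
    ⨾-mono    : ∀ {X Y Z} {f f' : Hom X Y} {g g' : Hom Y Z} →
                f ≤ f' → g ≤ g' → f ⨾ g ≤ f' ⨾ g'
    ⊗-mono    : ∀ {X Y X' Y'} {f g : Hom X Y} {f' g' : Hom X' Y'} →
                f ≤ g → f' ≤ g' → f ⊗₁ f' ≤ g ⊗₁ g'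

    α   : ∀ {X Y Z} → Hom ((X ⊗₀ Y) ⊗₀ Z) (X ⊗₀ (Y ⊗₀ Z))
    α⁻¹ : ∀ {X Y Z} → Hom (X ⊗₀ (Y ⊗₀ Z)) ((X ⊗₀ Y) ⊗₀ Z)
    λ′  : ∀ {X} → Hom (I ⊗₀ X) X
    λ⁻¹ : ∀ {X} → Hom X (I ⊗₀ X)
    ρ   : ∀ {X} → Hom (X ⊗₀ I) X
    ρ⁻¹ : ∀ {X} → Hom X (X ⊗₀ I)
    σ   : ∀ {X Y} → Hom (X ⊗₀ Y) (Y ⊗₀ X)

    α-iso₁ : ∀ {X Y Z} → α {X} {Y} {Z} ⨾ α⁻¹ ≡ id
    α-iso₂ : ∀ {X Y Z} → α⁻¹ {X} {Y} {Z} ⨾ α ≡ id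
    λ-iso₁ : ∀ {X} → λ′ {X} ⨾ λ⁻¹ ≡ id
    λ-iso₂ : ∀ {X} → λ⁻¹ {X} ⨾ λ′ ≡ id
    ρ-iso₁ : ∀ {X} → ρ {X} ⨾ ρ⁻¹ ≡ id
    ρ-iso₂ : ∀ {X} → ρ⁻¹ {X} ⨾ ρ ≡ id
    σ-inv  : ∀ {X Y} → σ {X} {Y} ⨾ σ ≡ id

    α-nat : ∀ {X Y Z X' Y' Z'} {f : Hom X X'} {g : Hom Y Y'} {h : Hom Z Z'} →
            ((f ⊗₁ g) ⊗₁ h) ⨾ α ≡ α ⨾ (f ⊗₁ (g ⊗₁ h))
    λ-nat : ∀ {X Y} {f : Hom X Y} → (id ⊗₁ f) ⨾ λ′ ≡ λ′ ⨾ f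
    ρ-nat : ∀ {X Y} {f : Hom X Y} → (f ⊗₁ id) ⨾ ρ ≡ ρ ⨾ f
    σ-nat : ∀ {X Y X' Y'} {f : Hom X Y} {g : Hom X' Y'} →
            (f ⊗₁ g) ⨾ σ ≡ σ ⨾ (g ⊗₁ f)

    pentagon : ∀ {W X Y Z} →
               (α {W} {X} {Y} ⊗₁ id {Z}) ⨾ α ⨾ (id ⊗₁ α) ≡ α ⨾ α
    triangle : ∀ {X Y} → α {X} {I} {Y} ⨾ (id ⊗₁ λ′) ≡ ρ ⊗₁ id
    hexagon  : ∀ {X Y Z} →
               α {X} {Y} {Z} ⨾ σ ⨾ α ≡ (σ ⊗₁ id) ⨾ α ⨾ (id ⊗₁ σ)

    copy   : ∀ {X} → Hom X (X ⊗₀ X)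
    disc   : ∀ {X} → Hom X I
    cocopy : ∀ {X} → Hom (X ⊗₀ X) X
    codisc : ∀ {X} → Hom I X

    copy-assoc : ∀ {X} → copy {X} ⨾ (copy ⊗₁ id) ⨾ α ≡ copy ⨾ (id ⊗₁ copy)
    copy-unitˡ : ∀ {X} → copy {X} ⨾ (disc ⊗₁ id) ⨾ λ′ ≡ id
    copy-unitʳ : ∀ {X} → copy {X} ⨾ (id ⊗₁ disc) ⨾ ρ ≡ id
    copy-comm  : ∀ {X} → copy {X} ⨾ σ ≡ copy
    cocopy-assoc : ∀ {X} → (cocopy {X} ⊗₁ id) ⨾ cocopy ≡ α ⨾ (id ⊗₁ cocopy) ⨾ cocopy
    cocopy-unitˡ : ∀ {X} → λ⁻¹ ⨾ (codisc ⊗₁ id) ⨾ cocopy {X} ≡ id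
    cocopy-unitʳ : ∀ {X} → ρ⁻¹ ⨾ (id ⊗₁ codisc) ⨾ cocopy {X} ≡ id
    cocopy-comm  : ∀ {X} → σ ⨾ cocopy {X} ≡ cocopy

    -- coherence with ⊗ (via the middle-four interchange built from α, σ)
    copy-⊗   : ∀ {X Y} → copy {X ⊗₀ Y} ≡
               (copy ⊗₁ copy) ⨾ α ⨾ (id ⊗₁ α⁻¹) ⨾ (id ⊗₁ (σ ⊗₁ id)) ⨾ (id ⊗₁ α) ⨾ α⁻¹
    disc-⊗   : ∀ {X Y} → disc {X ⊗₀ Y} ≡ (disc ⊗₁ disc) ⨾ λ′
    copy-I   : copy {I} ≡ λ⁻¹
    disc-I   : disc {I} ≡ id
    cocopy-⊗ : ∀ {X Y} → cocopy {X ⊗₀ Y} ≡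
               α ⨾ (id ⊗₁ α⁻¹) ⨾ (id ⊗₁ (σ ⊗₁ id)) ⨾ (id ⊗₁ α) ⨾ α⁻¹ ⨾ (cocopy ⊗₁ cocopy)
    codisc-⊗ : ∀ {X Y} → codisc {X ⊗₀ Y} ≡ λ⁻¹ ⨾ (codisc ⊗₁ codisc)
    cocopy-I : cocopy {I} ≡ λ′
    codisc-I : codisc {I} ≡ id

    lax-copy : ∀ {X Y} {f : Hom X Y} → f ⨾ copy ≤ copy ⨾ (f ⊗₁ f)
    lax-disc : ∀ {X Y} {f : Hom X Y} → f ⨾ disc ≤ disc

    frobeniusˡ : ∀ {X} → (copy {X} ⊗₁ id) ⨾ α ⨾ (id ⊗₁ cocopy) ≡ cocopy ⨾ copy
    frobeniusʳ : ∀ {X} → (id ⊗₁ copy {X}) ⨾ α⁻¹ ⨾ (cocopy ⊗₁ id) ≡ cocopy ⨾ copy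
    special    : ∀ {X} → copy {X} ⨾ cocopy ≡ id

    codisc-disc : ∀ {X} → codisc {X} ⨾ disc ≤ id
    cocopy-copy : ∀ {X} → cocopy {X} ⨾ copy ≤ id
    id-disc     : ∀ {X} → id {X} ≤ disc ⨾ codisc
    id-copy     : ∀ {X} → id {X} ≤ copy ⨾ cocopy

module Derived {o ℓ e} (C : CartesianBicategory o ℓ e) where
  open CartesianBicategory C

  _⊓_ : ∀ {X Y} → Hom X Y → Hom X Y → Hom X Y
  f ⊓ g = copy ⨾ (f ⊗₁ g) ⨾ cocopy

  -- f† := (id_Y ⊗ (codisc;copy)) ; (id_Y ⊗ f ⊗ id_X) ; ((cocopy;disc) ⊗ id_X),
  -- with the unitors and associator made explicit.
  _† : ∀ {X Y} → Hom X Y → Hom Y X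
  f † = ρ⁻¹ ⨾ (id ⊗₁ (codisc ⨾ copy)) ⨾ α⁻¹ ⨾ ((id ⊗₁ f) ⊗₁ id)
        ⨾ ((cocopy ⨾ disc) ⊗₁ id) ⨾ λ′

  Coreflexive : ∀ {X} → Hom X X → Set e
  Coreflexive f = f ≤ id

  SingleValued : ∀ {X Y} → Hom X Y → Set e
  SingleValued f = copy ⨾ (f ⊗₁ f) ≤ f ⨾ copy

  Injective : ∀ {X Y} → Hom X Y → Set e
  Injective f = (f ⊗₁ f) ⨾ cocopy ≤ cocopy ⨾ f

  i : ∀ {X} → Hom X X → Hom I X
  i h = codisc ⨾ h

  c : ∀ {X} → Hom I X → Hom X X
  c k = λ⁻¹ ⨾ (k ⊗₁ id) ⨾ cocopy

-- A coreflexive f ≤ id satisfies f ⊓ id = f: the meet is below f since id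
-- is below the top disc ⨾ codisc, and f ≤ f ⊓ f ≤ f ⊓ id because f copies
-- laxly. Writing f as copy ⨾ (f ⊗ id) ⨾ cocopy and applying the Frobenius
-- law lets f slide through copy and cocopy onto a single wire; every
-- equational claim, including f = f†, is a consequence of this sliding.
-- Conversely, an idempotent self-converse f is f† ⨾ f, which is obtained
-- by bending the wires of codisc ⨾ copy ⨾ (f ⊗ f); single-valuedness bounds
-- this by the bent form of codisc ⨾ f ⨾ copy, which is below id because
-- every point I → X is below codisc.
module Submission where

open import Defs
open import Relation.Binary.Bundles using (Preorder)
import Relation.Binary.Reasoning.Preorder
open import Relation.Binary.PropositionalEquality
  using (_≡_; refl; sym; trans; cong; cong₂; isEquivalence; module ≡-Reasoning)
open import Data.Product using (_×_; _,_)

module CoreflexiveProperties {o ℓ e} (C : CartesianBicategory o ℓ e) where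
  open CartesianBicategory C
  open Derived C

  ≡⇒≤ : ∀ {X Y} {f g : Hom X Y} → f ≡ g → f ≤ g
  ≡⇒≤ refl = ≤-refl

  hom-preorder : Obj → Obj → Preorder ℓ ℓ e
  hom-preorder X Y = record
    { Carrier    = Hom X Y
    ; _≈_        = _≡_
    ; _≲_        = _≤_
    ; isPreorder = record
      { isEquivalence = isEquivalence
      ; reflexive     = ≡⇒≤
      ; trans         = ≤-trans
      }
    }

  module ≤-Reasoning {X Y : Obj} =
    Relation.Binary.Reasoning.Preorder (hom-preorder X Y)

  pullˡ : ∀ {W X Y Z} {a : Hom W X} {b : Hom X Y} {d : Hom W Y} {x : Hom Y Z} →
          a ⨾ b ≡ d → a ⨾ b ⨾ x ≡ d ⨾ x
  pullˡ p = trans (sym assoc) (cong (_⨾ _) p)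

  pull³ˡ : ∀ {V W X Y Z} {a : Hom V W} {b : Hom W X} {b′ : Hom X Y} {d : Hom V Y}
             {x : Hom Y Z} →
           a ⨾ b ⨾ b′ ≡ d → a ⨾ b ⨾ b′ ⨾ x ≡ d ⨾ x
  pull³ˡ p = trans (cong (_ ⨾_) (sym assoc)) (pullˡ p)

  conjugate : ∀ {A A′ B B′} {a : Hom A A′} {b : Hom B B′} {u : Hom A B}
                {u₂ : Hom A′ B′} {v : Hom B A} {v₂ : Hom B′ A′} →
              a ⨾ u₂ ≡ u ⨾ b → v ⨾ u ≡ id → u₂ ⨾ v₂ ≡ id → v ⨾ a ≡ b ⨾ v₂
  conjugate {a = a} {b} {u} {u₂} {v} {v₂} nat vu u₂v₂ = begin
    v ⨾ a               ≡⟨ cong (v ⨾_) (sym identityʳ) ⟩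
    v ⨾ a ⨾ id          ≡⟨ cong (λ z → v ⨾ a ⨾ z) (sym u₂v₂) ⟩
    v ⨾ a ⨾ u₂ ⨾ v₂     ≡⟨ cong (v ⨾_) (pullˡ nat) ⟩
    v ⨾ (u ⨾ b) ⨾ v₂    ≡⟨ cong (v ⨾_) assoc ⟩
    v ⨾ u ⨾ b ⨾ v₂      ≡⟨ pullˡ vu ⟩
    id ⨾ b ⨾ v₂         ≡⟨ identityˡ ⟩
    b ⨾ v₂              ∎
    where open ≡-Reasoning

  α⁻¹-nat : ∀ {X Y Z X′ Y′ Z′} {f : Hom X X′} {g : Hom Y Y′} {h : Hom Z Z′} →
            (f ⊗₁ (g ⊗₁ h)) ⨾ α⁻¹ ≡ α⁻¹ ⨾ ((f ⊗₁ g) ⊗₁ h)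
  α⁻¹-nat = sym (conjugate α-nat α-iso₂ α-iso₁)

  λ⁻¹-nat : ∀ {X Y} {f : Hom X Y} → f ⨾ λ⁻¹ ≡ λ⁻¹ ⨾ (id ⊗₁ f)
  λ⁻¹-nat = sym (conjugate λ-nat λ-iso₂ λ-iso₁)

  ⨾⊗id : ∀ {W X Y Z} {a : Hom X Y} {b : Hom Y Z} →
         (a ⨾ b) ⊗₁ id {W} ≡ (a ⊗₁ id) ⨾ (b ⊗₁ id)
  ⨾⊗id = trans (cong (_ ⊗₁_) (sym identityˡ)) ⊗-⨾

  id⊗⨾ : ∀ {W X Y Z} {a : Hom X Y} {b : Hom Y Z} →
         id {W} ⊗₁ (a ⨾ b) ≡ (id ⊗₁ a) ⨾ (id ⊗₁ b)
  id⊗⨾ = trans (cong (_⊗₁ _) (sym identityˡ)) ⊗-⨾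

  ⊗-first-second : ∀ {X Y X′ Y′} {f : Hom X Y} {g : Hom X′ Y′} →
                   f ⊗₁ g ≡ (f ⊗₁ id) ⨾ (id ⊗₁ g)
  ⊗-first-second = trans (cong₂ _⊗₁_ (sym identityʳ) (sym identityˡ)) ⊗-⨾

  ⊗-second-first : ∀ {X Y X′ Y′} {f : Hom X Y} {g : Hom X′ Y′} →
                   f ⊗₁ g ≡ (id ⊗₁ g) ⨾ (f ⊗₁ id)
  ⊗-second-first = trans (cong₂ _⊗₁_ (sym identityˡ) (sym identityʳ)) ⊗-⨾

  first-second-commute : ∀ {X Y X′ Y′} {f : Hom X Y} {g : Hom X′ Y′} →
                         (f ⊗₁ id) ⨾ (id ⊗₁ g) ≡ (id ⊗₁ g) ⨾ (f ⊗₁ id)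
  first-second-commute = trans (sym ⊗-first-second) ⊗-second-first

  copy-assoc⁻¹ : ∀ {X} → copy {X} ⨾ (id ⊗₁ copy) ⨾ α⁻¹ ≡ copy ⨾ (copy ⊗₁ id)
  copy-assoc⁻¹ = begin
    copy ⨾ (id ⊗₁ copy) ⨾ α⁻¹          ≡⟨ pullˡ (sym copy-assoc) ⟩
    (copy ⨾ (copy ⊗₁ id) ⨾ α) ⨾ α⁻¹    ≡⟨ trans assoc (cong (copy ⨾_) assoc) ⟩
    copy ⨾ (copy ⊗₁ id) ⨾ α ⨾ α⁻¹      ≡⟨ cong (λ z → copy ⨾ (copy ⊗₁ id) ⨾ z) α-iso₁ ⟩
    copy ⨾ (copy ⊗₁ id) ⨾ id           ≡⟨ cong (copy ⨾_) identityʳ ⟩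
    copy ⨾ (copy ⊗₁ id)                ∎
    where open ≡-Reasoning

  ≤-disc⨾codisc : ∀ {X Y} (g : Hom X Y) → g ≤ disc ⨾ codisc
  ≤-disc⨾codisc g = begin
    g                     ≡⟨ identityʳ ⟨
    g ⨾ id                ≲⟨ ⨾-mono ≤-refl id-disc ⟩
    g ⨾ disc ⨾ codisc     ≡⟨ assoc ⟨
    (g ⨾ disc) ⨾ codisc   ≲⟨ ⨾-mono lax-disc ≤-refl ⟩
    disc ⨾ codisc         ∎
    where open ≤-Reasoning

  ≤-codisc : ∀ {X} (k : Hom I X) → k ≤ codisc
  ≤-codisc k = ≤-trans (≤-disc⨾codisc k)
                       (≡⇒≤ (trans (cong (_⨾ codisc) disc-I) identityˡ))

  ⊓-mono : ∀ {X Y} {f f′ g g′ : Hom X Y} → f ≤ f′ → g ≤ g′ → f ⊓ g ≤ f′ ⊓ g′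
  ⊓-mono f≤f′ g≤g′ = ⨾-mono ≤-refl (⨾-mono (⊗-mono f≤f′ g≤g′) ≤-refl)

  ⊓-disc⨾codisc : ∀ {X Y} (f : Hom X Y) → f ⊓ (disc ⨾ codisc) ≡ f
  ⊓-disc⨾codisc f = begin
    copy ⨾ (f ⊗₁ (disc ⨾ codisc)) ⨾ cocopy
      ≡⟨ cong (λ z → copy ⨾ z ⨾ cocopy) (trans (cong (_⊗₁ _) (sym identityˡ)) ⊗-⨾) ⟩
    copy ⨾ ((id ⊗₁ disc) ⨾ (f ⊗₁ codisc)) ⨾ cocopy
      ≡⟨ cong (λ z → copy ⨾ ((id ⊗₁ disc) ⨾ z) ⨾ cocopy) ⊗-first-second ⟩
    copy ⨾ ((id ⊗₁ disc) ⨾ (f ⊗₁ id) ⨾ (id ⊗₁ codisc)) ⨾ cocopy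
      ≡⟨ cong (λ z → copy ⨾ ((id ⊗₁ disc) ⨾ z ⨾ (id ⊗₁ codisc)) ⨾ cocopy) f⊗id≡ρ⨾f⨾ρ⁻¹ ⟩
    copy ⨾ ((id ⊗₁ disc) ⨾ (ρ ⨾ f ⨾ ρ⁻¹) ⨾ (id ⊗₁ codisc)) ⨾ cocopy
      ≡⟨ cong (copy ⨾_) (trans assoc (cong ((id ⊗₁ disc) ⨾_)
                        (trans assoc (trans assoc (cong (ρ ⨾_) assoc))))) ⟩
    copy ⨾ (id ⊗₁ disc) ⨾ ρ ⨾ f ⨾ ρ⁻¹ ⨾ (id ⊗₁ codisc) ⨾ cocopy
      ≡⟨ trans (pull³ˡ copy-unitʳ) identityˡ ⟩
    f ⨾ ρ⁻¹ ⨾ (id ⊗₁ codisc) ⨾ cocopy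
      ≡⟨ trans (cong (f ⨾_) cocopy-unitʳ) identityʳ ⟩
    f ∎
    where
    open ≡-Reasoning
    f⊗id≡ρ⨾f⨾ρ⁻¹ : f ⊗₁ id ≡ ρ ⨾ f ⨾ ρ⁻¹
    f⊗id≡ρ⨾f⨾ρ⁻¹ = begin
      f ⊗₁ id               ≡⟨ identityʳ ⟨
      (f ⊗₁ id) ⨾ id        ≡⟨ cong ((f ⊗₁ id) ⨾_) ρ-iso₁ ⟨
      (f ⊗₁ id) ⨾ ρ ⨾ ρ⁻¹   ≡⟨ pullˡ ρ-nat ⟩
      (ρ ⨾ f) ⨾ ρ⁻¹         ≡⟨ assoc ⟩
      ρ ⨾ f ⨾ ρ⁻¹           ∎

  ⊓-≤ˡ : ∀ {X Y} (f g : Hom X Y) → f ⊓ g ≤ f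
  ⊓-≤ˡ f g = ≤-trans (⊓-mono ≤-refl (≤-disc⨾codisc g)) (≡⇒≤ (⊓-disc⨾codisc f))

  ≤-⊓-diag : ∀ {X Y} (f : Hom X Y) → f ≤ f ⊓ f
  ≤-⊓-diag f = begin
    f                             ≡⟨ identityʳ ⟨
    f ⨾ id                        ≡⟨ cong (f ⨾_) special ⟨
    f ⨾ copy ⨾ cocopy             ≡⟨ assoc ⟨
    (f ⨾ copy) ⨾ cocopy           ≲⟨ ⨾-mono lax-copy ≤-refl ⟩
    (copy ⨾ (f ⊗₁ f)) ⨾ cocopy    ≡⟨ assoc ⟩
    f ⊓ f                         ∎
    where open ≤-Reasoning

  ⊓-idem : ∀ {X Y} (f : Hom X Y) → f ⊓ f ≡ f
  ⊓-idem f = ≤-antisym (⊓-≤ˡ f f) (≤-⊓-diag f)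

  ⊓-codisc : ∀ {X} (k : Hom I X) → k ⊓ codisc ≡ k
  ⊓-codisc k = trans (cong (k ⊓_) (sym (trans (cong (_⨾ codisc) disc-I) identityˡ)))
                     (⊓-disc⨾codisc k)

  coreflexive⇒⊓-id : ∀ {X} {f : Hom X X} → Coreflexive f → f ⊓ id ≡ f
  coreflexive⇒⊓-id {f = f} f≤id =
    ≤-antisym (⊓-≤ˡ f id) (≤-trans (≤-⊓-diag f) (⊓-mono ≤-refl f≤id))

  module _ {X} {f : Hom X X} (f≤id : Coreflexive f) where

    private
      f⊓id≡f : f ⊓ id ≡ f
      f⊓id≡f = coreflexive⇒⊓-id f≤id

    coreflexive-copy : f ⨾ copy ≡ copy ⨾ (f ⊗₁ id)
    coreflexive-copy = begin
      f ⨾ copy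
        ≡⟨ cong (_⨾ copy) (sym f⊓id≡f) ⟩
      (copy ⨾ (f ⊗₁ id) ⨾ cocopy) ⨾ copy
        ≡⟨ trans assoc (cong (copy ⨾_) assoc) ⟩
      copy ⨾ (f ⊗₁ id) ⨾ cocopy ⨾ copy
        ≡⟨ cong (λ z → copy ⨾ (f ⊗₁ id) ⨾ z) frobeniusʳ ⟨
      copy ⨾ (f ⊗₁ id) ⨾ (id ⊗₁ copy) ⨾ α⁻¹ ⨾ (cocopy ⊗₁ id)
        ≡⟨ cong (copy ⨾_) (trans (pullˡ first-second-commute) assoc) ⟩
      copy ⨾ (id ⊗₁ copy) ⨾ (f ⊗₁ id) ⨾ α⁻¹ ⨾ (cocopy ⊗₁ id)
        ≡⟨ cong (λ z → copy ⨾ (id ⊗₁ copy) ⨾ (f ⊗₁ z) ⨾ α⁻¹ ⨾ (cocopy ⊗₁ id)) ⊗-id ⟨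
      copy ⨾ (id ⊗₁ copy) ⨾ (f ⊗₁ (id ⊗₁ id)) ⨾ α⁻¹ ⨾ (cocopy ⊗₁ id)
        ≡⟨ cong (λ z → copy ⨾ (id ⊗₁ copy) ⨾ z) (pullˡ α⁻¹-nat) ⟩
      copy ⨾ (id ⊗₁ copy) ⨾ (α⁻¹ ⨾ ((f ⊗₁ id) ⊗₁ id)) ⨾ (cocopy ⊗₁ id)
        ≡⟨ cong (λ z → copy ⨾ (id ⊗₁ copy) ⨾ z) (trans assoc (cong (α⁻¹ ⨾_) (sym ⨾⊗id))) ⟩
      copy ⨾ (id ⊗₁ copy) ⨾ α⁻¹ ⨾ (((f ⊗₁ id) ⨾ cocopy) ⊗₁ id)
        ≡⟨ pull³ˡ copy-assoc⁻¹ ⟩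
      (copy ⨾ (copy ⊗₁ id)) ⨾ (((f ⊗₁ id) ⨾ cocopy) ⊗₁ id)
        ≡⟨ trans assoc (cong (copy ⨾_) (sym ⨾⊗id)) ⟩
      copy ⨾ ((f ⊓ id) ⊗₁ id)
        ≡⟨ cong (λ z → copy ⨾ (z ⊗₁ id)) f⊓id≡f ⟩
      copy ⨾ (f ⊗₁ id) ∎
      where open ≡-Reasoning

    cocopy-coreflexiveˡ : cocopy ⨾ f ≡ (f ⊗₁ id) ⨾ cocopy
    cocopy-coreflexiveˡ = begin
      cocopy ⨾ f
        ≡⟨ cong (cocopy ⨾_) (sym f⊓id≡f) ⟩
      cocopy ⨾ copy ⨾ (f ⊗₁ id) ⨾ cocopy
        ≡⟨ pullˡ (sym frobeniusˡ) ⟩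
      ((copy ⊗₁ id) ⨾ α ⨾ (id ⊗₁ cocopy)) ⨾ (f ⊗₁ id) ⨾ cocopy
        ≡⟨ trans assoc (cong ((copy ⊗₁ id) ⨾_) assoc) ⟩
      (copy ⊗₁ id) ⨾ α ⨾ (id ⊗₁ cocopy) ⨾ (f ⊗₁ id) ⨾ cocopy
        ≡⟨ cong (λ z → (copy ⊗₁ id) ⨾ α ⨾ z)
                (trans (pullˡ (sym first-second-commute)) assoc) ⟩
      (copy ⊗₁ id) ⨾ α ⨾ (f ⊗₁ id) ⨾ (id ⊗₁ cocopy) ⨾ cocopy
        ≡⟨ cong (λ z → (copy ⊗₁ id) ⨾ α ⨾ (f ⊗₁ z) ⨾ (id ⊗₁ cocopy) ⨾ cocopy) ⊗-id ⟨
      (copy ⊗₁ id) ⨾ α ⨾ (f ⊗₁ (id ⊗₁ id)) ⨾ (id ⊗₁ cocopy) ⨾ cocopy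
        ≡⟨ cong ((copy ⊗₁ id) ⨾_) (pullˡ (sym α-nat)) ⟩
      (copy ⊗₁ id) ⨾ (((f ⊗₁ id) ⊗₁ id) ⨾ α) ⨾ (id ⊗₁ cocopy) ⨾ cocopy
        ≡⟨ cong ((copy ⊗₁ id) ⨾_)
                (trans assoc (cong (((f ⊗₁ id) ⊗₁ id) ⨾_) (sym cocopy-assoc))) ⟩
      (copy ⊗₁ id) ⨾ ((f ⊗₁ id) ⊗₁ id) ⨾ (cocopy ⊗₁ id) ⨾ cocopy
        ≡⟨ cong ((copy ⊗₁ id) ⨾_) (pullˡ (sym ⨾⊗id)) ⟩
      (copy ⊗₁ id) ⨾ (((f ⊗₁ id) ⨾ cocopy) ⊗₁ id) ⨾ cocopy
        ≡⟨ pullˡ (sym ⨾⊗id) ⟩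
      ((f ⊓ id) ⊗₁ id) ⨾ cocopy
        ≡⟨ cong (λ z → (z ⊗₁ id) ⨾ cocopy) f⊓id≡f ⟩
      (f ⊗₁ id) ⨾ cocopy ∎
      where open ≡-Reasoning

    cocopy-coreflexiveʳ : cocopy ⨾ f ≡ (id ⊗₁ f) ⨾ cocopy
    cocopy-coreflexiveʳ = begin
      cocopy ⨾ f                 ≡⟨ pullˡ cocopy-comm ⟨
      σ ⨾ cocopy ⨾ f             ≡⟨ cong (σ ⨾_) cocopy-coreflexiveˡ ⟩
      σ ⨾ (f ⊗₁ id) ⨾ cocopy     ≡⟨ trans (pullˡ σ-nat) assoc ⟨
      (id ⊗₁ f) ⨾ σ ⨾ cocopy     ≡⟨ cong ((id ⊗₁ f) ⨾_) cocopy-comm ⟩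
      (id ⊗₁ f) ⨾ cocopy         ∎
      where open ≡-Reasoning

    id-⊓-coreflexive : id ⊓ f ≡ f
    id-⊓-coreflexive = begin
      copy ⨾ (id ⊗₁ f) ⨾ cocopy   ≡⟨ cong (copy ⨾_) cocopy-coreflexiveʳ ⟨
      copy ⨾ cocopy ⨾ f           ≡⟨ pullˡ special ⟩
      id ⨾ f                      ≡⟨ identityˡ ⟩
      f                           ∎
      where open ≡-Reasoning

    coreflexive-singleValued : SingleValued f
    coreflexive-singleValued =
      ≤-trans (⨾-mono ≤-refl (⊗-mono ≤-refl f≤id)) (≡⇒≤ (sym coreflexive-copy))

    coreflexive-injective : Injective f
    coreflexive-injective =
      ≤-trans (⨾-mono (⊗-mono ≤-refl f≤id) ≤-refl) (≡⇒≤ (sym cocopy-coreflexiveˡ))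

  coreflexive-⨾≡⊓ : ∀ {X} {f g : Hom X X} → Coreflexive f → Coreflexive g →
                    f ⨾ g ≡ f ⊓ g
  coreflexive-⨾≡⊓ {f = f} {g} f≤id g≤id = begin
    f ⨾ g                         ≡⟨ cong (f ⨾_) (id-⊓-coreflexive g≤id) ⟨
    f ⨾ copy ⨾ (id ⊗₁ g) ⨾ cocopy ≡⟨ pullˡ (coreflexive-copy f≤id) ⟩
    (copy ⨾ (f ⊗₁ id)) ⨾ (id ⊗₁ g) ⨾ cocopy
                                  ≡⟨ trans assoc (cong (copy ⨾_) (pullˡ (sym ⊗-first-second))) ⟩
    f ⊓ g                         ∎
    where open ≡-Reasoning

  coreflexive-idem : ∀ {X} {f : Hom X X} → Coreflexive f → f ⨾ f ≡ f
  coreflexive-idem {f = f} f≤id = trans (coreflexive-⨾≡⊓ f≤id f≤id) (⊓-idem f)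

  -- unname m bends the first output of m : I → X ⊗ X back into an input.
  cap : ∀ {X} → Hom (X ⊗₀ X) I
  cap = cocopy ⨾ disc

  unname : ∀ {X} → Hom I (X ⊗₀ X) → Hom X X
  unname m = ρ⁻¹ ⨾ (id ⊗₁ m) ⨾ α⁻¹ ⨾ (cap ⊗₁ id) ⨾ λ′

  unname-mono : ∀ {X} {m m′ : Hom I (X ⊗₀ X)} → m ≤ m′ → unname m ≤ unname m′
  unname-mono m≤m′ = ⨾-mono ≤-refl (⨾-mono (⊗-mono ≤-refl m≤m′) ≤-refl)

  c′ : ∀ {X} → Hom I X → Hom X X
  c′ k = ρ⁻¹ ⨾ (id ⊗₁ k) ⨾ cocopy

  c′-coreflexive : ∀ {X} (k : Hom I X) → Coreflexive (c′ k)
  c′-coreflexive k =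
    ≤-trans (⨾-mono ≤-refl (⨾-mono (⊗-mono ≤-refl (≤-codisc k)) ≤-refl))
            (≡⇒≤ cocopy-unitʳ)

  snake : ∀ {X} → (id ⊗₁ copy {X}) ⨾ α⁻¹ ⨾ (cap ⊗₁ id) ⨾ λ′ ≡ cocopy
  snake = begin
    (id ⊗₁ copy) ⨾ α⁻¹ ⨾ (cap ⊗₁ id) ⨾ λ′
      ≡⟨ cong (λ z → (id ⊗₁ copy) ⨾ α⁻¹ ⨾ z) (trans (cong (_⨾ λ′) ⨾⊗id) assoc) ⟩
    (id ⊗₁ copy) ⨾ α⁻¹ ⨾ (cocopy ⊗₁ id) ⨾ (disc ⊗₁ id) ⨾ λ′
      ≡⟨ pull³ˡ frobeniusʳ ⟩
    (cocopy ⨾ copy) ⨾ (disc ⊗₁ id) ⨾ λ′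
      ≡⟨ trans assoc (trans (cong (cocopy ⨾_) copy-unitˡ) identityʳ) ⟩
    cocopy ∎
    where open ≡-Reasoning

  unname-copy : ∀ {X} (k : Hom I X) → unname (k ⨾ copy) ≡ c′ k
  unname-copy k = begin
    ρ⁻¹ ⨾ (id ⊗₁ (k ⨾ copy)) ⨾ α⁻¹ ⨾ (cap ⊗₁ id) ⨾ λ′
      ≡⟨ cong (λ z → ρ⁻¹ ⨾ z ⨾ α⁻¹ ⨾ (cap ⊗₁ id) ⨾ λ′) id⊗⨾ ⟩
    ρ⁻¹ ⨾ ((id ⊗₁ k) ⨾ (id ⊗₁ copy)) ⨾ α⁻¹ ⨾ (cap ⊗₁ id) ⨾ λ′
      ≡⟨ cong (ρ⁻¹ ⨾_) (trans assoc (cong ((id ⊗₁ k) ⨾_) snake)) ⟩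
    c′ k ∎
    where open ≡-Reasoning

  †-⨾ : ∀ {X} (f g : Hom X X) → f † ⨾ g ≡ unname (codisc ⨾ copy ⨾ (f ⊗₁ g))
  †-⨾ f g = begin
    f † ⨾ g
      ≡⟨ trans assoc (cong (ρ⁻¹ ⨾_) (trans assoc (cong ((id ⊗₁ (codisc ⨾ copy)) ⨾_)
           (trans assoc (cong (α⁻¹ ⨾_) (trans assoc (cong (((id ⊗₁ f) ⊗₁ id) ⨾_) assoc))))))) ⟩
    ρ⁻¹ ⨾ (id ⊗₁ (codisc ⨾ copy)) ⨾ α⁻¹ ⨾ ((id ⊗₁ f) ⊗₁ id) ⨾ (cap ⊗₁ id) ⨾ λ′ ⨾ g
      ≡⟨ cong (λ z → ρ⁻¹ ⨾ (id ⊗₁ (codisc ⨾ copy)) ⨾ α⁻¹ ⨾ ((id ⊗₁ f) ⊗₁ id) ⨾ z)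
              (trans (cong ((cap ⊗₁ id) ⨾_) (sym λ-nat))
                     (trans (pullˡ first-second-commute) assoc)) ⟩
    ρ⁻¹ ⨾ (id ⊗₁ (codisc ⨾ copy)) ⨾ α⁻¹ ⨾ ((id ⊗₁ f) ⊗₁ id) ⨾ (id ⊗₁ g) ⨾ (cap ⊗₁ id) ⨾ λ′
      ≡⟨ cong (λ z → ρ⁻¹ ⨾ (id ⊗₁ (codisc ⨾ copy)) ⨾ α⁻¹ ⨾ z)
              (pullˡ (sym ⊗-first-second)) ⟩
    ρ⁻¹ ⨾ (id ⊗₁ (codisc ⨾ copy)) ⨾ α⁻¹ ⨾ ((id ⊗₁ f) ⊗₁ g) ⨾ (cap ⊗₁ id) ⨾ λ′
      ≡⟨ cong (λ z → ρ⁻¹ ⨾ (id ⊗₁ (codisc ⨾ copy)) ⨾ z)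
              (trans (pullˡ (sym α⁻¹-nat)) assoc) ⟩
    ρ⁻¹ ⨾ (id ⊗₁ (codisc ⨾ copy)) ⨾ (id ⊗₁ (f ⊗₁ g)) ⨾ α⁻¹ ⨾ (cap ⊗₁ id) ⨾ λ′
      ≡⟨ cong (ρ⁻¹ ⨾_) (pullˡ (trans (sym id⊗⨾) (cong (id ⊗₁_) assoc))) ⟩
    unname (codisc ⨾ copy ⨾ (f ⊗₁ g)) ∎
    where open ≡-Reasoning

  c′-i : ∀ {X} {f : Hom X X} → Coreflexive f → c′ (i f) ≡ f
  c′-i {f = f} f≤id = begin
    ρ⁻¹ ⨾ (id ⊗₁ (codisc ⨾ f)) ⨾ cocopy
      ≡⟨ cong (λ z → ρ⁻¹ ⨾ z ⨾ cocopy) id⊗⨾ ⟩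
    ρ⁻¹ ⨾ ((id ⊗₁ codisc) ⨾ (id ⊗₁ f)) ⨾ cocopy
      ≡⟨ cong (ρ⁻¹ ⨾_) (trans assoc (cong (_ ⨾_) (sym (cocopy-coreflexiveʳ f≤id)))) ⟩
    ρ⁻¹ ⨾ (id ⊗₁ codisc) ⨾ cocopy ⨾ f
      ≡⟨ trans (pull³ˡ cocopy-unitʳ) identityˡ ⟩
    f ∎
    where open ≡-Reasoning

  coreflexive-† : ∀ {X} {f : Hom X X} → Coreflexive f → f ≡ f †
  coreflexive-† {f = f} f≤id = sym (begin
    f †                             ≡⟨ identityʳ ⟨
    f † ⨾ id                        ≡⟨ †-⨾ f id ⟩
    unname (codisc ⨾ copy ⨾ (f ⊗₁ id))
                                    ≡⟨ cong (λ z → unname (codisc ⨾ z)) (coreflexive-copy f≤id) ⟨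
    unname (codisc ⨾ f ⨾ copy)      ≡⟨ cong unname (sym assoc) ⟩
    unname ((codisc ⨾ f) ⨾ copy)    ≡⟨ unname-copy (codisc ⨾ f) ⟩
    c′ (i f)                        ≡⟨ c′-i f≤id ⟩
    f                               ∎)
    where open ≡-Reasoning

  idem-†-singleValued⇒coreflexive : ∀ {X} {f : Hom X X} →
    f ⨾ f ≡ f → f ≡ f † → SingleValued f → Coreflexive f
  idem-†-singleValued⇒coreflexive {f = f} ff≡f f≡f† f-sv = begin
    f                                   ≡⟨ ff≡f ⟨
    f ⨾ f                               ≡⟨ cong (_⨾ f) f≡f† ⟩
    f † ⨾ f                             ≡⟨ †-⨾ f f ⟩
    unname (codisc ⨾ copy ⨾ (f ⊗₁ f))   ≲⟨ unname-mono (⨾-mono ≤-refl f-sv) ⟩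
    unname (codisc ⨾ f ⨾ copy)          ≡⟨ cong unname (sym assoc) ⟩
    unname ((codisc ⨾ f) ⨾ copy)        ≡⟨ unname-copy (codisc ⨾ f) ⟩
    c′ (codisc ⨾ f)                     ≲⟨ c′-coreflexive (codisc ⨾ f) ⟩
    id                                  ∎
    where open ≤-Reasoning

  c-i : ∀ {X} {h : Hom X X} → Coreflexive h → c (i h) ≡ h
  c-i {h = h} h≤id = begin
    λ⁻¹ ⨾ ((codisc ⨾ h) ⊗₁ id) ⨾ cocopy
      ≡⟨ cong (λ z → λ⁻¹ ⨾ z ⨾ cocopy) ⨾⊗id ⟩
    λ⁻¹ ⨾ ((codisc ⊗₁ id) ⨾ (h ⊗₁ id)) ⨾ cocopy
      ≡⟨ cong (λ⁻¹ ⨾_) (trans assoc (cong (_ ⨾_) (sym (cocopy-coreflexiveˡ h≤id)))) ⟩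
    λ⁻¹ ⨾ (codisc ⊗₁ id) ⨾ cocopy ⨾ h
      ≡⟨ trans (pull³ˡ cocopy-unitˡ) identityˡ ⟩
    h ∎
    where open ≡-Reasoning

  c-coreflexive : ∀ {X} (k : Hom I X) → Coreflexive (c k)
  c-coreflexive k =
    ≤-trans (⨾-mono ≤-refl (⨾-mono (⊗-mono (≤-codisc k) ≤-refl) ≤-refl))
            (≡⇒≤ cocopy-unitˡ)

  i-c : ∀ {X} (k : Hom I X) → i (c k) ≡ k
  i-c k = begin
    codisc ⨾ λ⁻¹ ⨾ (k ⊗₁ id) ⨾ cocopy
      ≡⟨ pullˡ λ⁻¹-nat ⟩
    (λ⁻¹ ⨾ (id ⊗₁ codisc)) ⨾ (k ⊗₁ id) ⨾ cocopy
      ≡⟨ trans assoc (cong (λ⁻¹ ⨾_) (pullˡ (sym ⊗-second-first))) ⟩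
    λ⁻¹ ⨾ (k ⊗₁ codisc) ⨾ cocopy
      ≡⟨ cong (_⨾ _) copy-I ⟨
    k ⊓ codisc
      ≡⟨ ⊓-codisc k ⟩
    k ∎
    where open ≡-Reasoning

  point-⨾-coreflexive : ∀ {X} (h : Hom I X) {g : Hom X X} → Coreflexive g →
                        h ⨾ g ≡ h ⊓ i g
  point-⨾-coreflexive h {g} g≤id = begin
    h ⨾ g
      ≡⟨ cong (_⨾ g) (⊓-codisc h) ⟨
    (copy ⨾ (h ⊗₁ codisc) ⨾ cocopy) ⨾ g
      ≡⟨ trans assoc (cong (copy ⨾_) assoc) ⟩
    copy ⨾ (h ⊗₁ codisc) ⨾ cocopy ⨾ g
      ≡⟨ cong (λ z → copy ⨾ (h ⊗₁ codisc) ⨾ z) (cocopy-coreflexiveʳ g≤id) ⟩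
    copy ⨾ (h ⊗₁ codisc) ⨾ (id ⊗₁ g) ⨾ cocopy
      ≡⟨ cong (copy ⨾_) (pullˡ (sym (trans (cong (_⊗₁ _) (sym identityʳ)) ⊗-⨾))) ⟩
    h ⊓ i g ∎
    where open ≡-Reasoning

lemma8p7 : ∀ {o ℓ e} (C : CartesianBicategory o ℓ e) →
  let open CartesianBicategory C
      open Derived C
  in (∀ {X} (f g : Hom X X) → Coreflexive f → Coreflexive g →
        (f ⨾ copy ≡ copy ⨾ (f ⊗₁ id))
        × (f ⨾ g ≡ f ⊓ g)
        × (f ⨾ f ≡ f)
        × (f ≡ f †)
        × SingleValued f
        × Injective f)
   × (∀ {X} → (∀ (h : Hom X X) → Coreflexive h → c (i h) ≡ h)
            × (∀ (k : Hom I X) → Coreflexive (c k) × (i (c k) ≡ k)))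
   × (∀ {X} (h : Hom I X) (g : Hom X X) → Coreflexive g → h ⨾ g ≡ h ⊓ i g)
   × (∀ {X} (f : Hom X X) → f ⨾ f ≡ f → f ≡ f † → SingleValued f → Coreflexive f)
lemma8p7 C =
  (λ f g f≤id g≤id →
      coreflexive-copy f≤id
    , coreflexive-⨾≡⊓ f≤id g≤id
    , coreflexive-idem f≤id
    , coreflexive-† f≤id
    , coreflexive-singleValued f≤id
    , coreflexive-injective f≤id)
  , ((λ h → c-i) , (λ k → c-coreflexive k , i-c k))
  , (λ h g → point-⨾-coreflexive h)
  , (λ f → idem-†-singleValued⇒coreflexive)
  where open CoreflexiveProperties C
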